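{- Let $k,\ell$ be integers with $1\le\ell\le k$. Then $\overline{\alpha}(\{1,2k,2k+2\ell\})\ge\frac{2k}{4k+2\ell}$.
   Context: For a finite set $S$ of positive integers, the distance graph $G(S)$ has vertex set $\mathbb{Z}$, with $i,j$ adjacent iff $|i-j|\in S$. For $A\subseteq\mathbb{Z}$, $\delta(A)=\limsup_{N\to\infty}\frac{|A\cap[-N,N]|}{2N+1}$. The independence ratio $\overline{\alpha}(S)$ is the supremum of $\delta(A)$ over all independent sets $A$ of $G(S)$. -}

module Defs where

open import Data.Bool using (Bool; true; false; if_then_else_)
open import Data.Nat as ℕ using (ℕ; suc; NonZero)
open import Data.Integer as ℤ using (ℤ; +_; ∣_∣)
open import Data.List using (List; map; upTo)
open import Data.Nat.ListAction using (sum)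
open import Data.List.Membership.Propositional using (_∈_)
open import Data.Product using (∃; _×_)
open import Data.Rational as ℚ using (ℚ; _/_; 0ℚ)
open import Relation.Binary.PropositionalEquality using (_≡_)
open import Relation.Nullary using (¬_)

-- A finite set S of positive integers is given as a list of naturals.
-- The distance graph G(S): vertices ℤ, i ~ j iff |i - j| ∈ S.
Adjacent : List ℕ → ℤ → ℤ → Set
Adjacent S i j = ∣ i ℤ.- j ∣ ∈ S

Independent : List ℕ → (ℤ → Bool) → Set
Independent S A = ∀ i j → A i ≡ true → A j ≡ true → ¬ Adjacent S i j

window : ℕ → List ℤ
window N = map (λ i → + i ℤ.- + N) (upTo (suc (N ℕ.+ N)))

count : (ℤ → Bool) → ℕ → ℕ
count A N = sum (map (λ i → if A i then 1 else 0) (window N))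

ratio : (ℤ → Bool) → ℕ → ℚ
ratio A N = (+ count A N) / suc (N ℕ.+ N)

-- "ᾱ(S) ≥ r", unfolded: sup over independent A of limsup ratio ≥ r, i.e.
-- for every ε > 0 there is an independent A and arbitrarily large N with
-- ratio A N ≥ r - ε.
IndependenceRatio≥ : List ℕ → ℚ → Set
IndependenceRatio≥ S r =
  ∀ (ε : ℚ) → 0ℚ ℚ.< ε →
    ∃ λ (A : ℤ → Bool) → Independent S A ×
      (∀ (N₀ : ℕ) → ∃ λ (N : ℕ) → N₀ ℕ.≤ N × (r ℚ.- ε) ℚ.≤ ratio A N)

-- The rational p / q for natural numbers p, q (with the junk value 0 when q = 0;
-- only used with q ≠ 0).
frac : ℕ → ℕ → ℚ
frac p ℕ.zero    = 0ℚ
frac p (suc q)   = (+ p) / suc q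

-- Let p = 4k + 2ℓ and let C ⊆ ℤ/p consist of the k even residues in [0, 2k) and
-- the k odd residues in [2k, 4k). Adding 1 flips parity, and the only step from
-- the lower block into the upper one lands on the even 2k; the gap [4k, p) has
-- length 2ℓ ≥ 2, so nothing wraps around. Adding 2k preserves parity, sends the
-- lower block to even residues of [2k, 4k) and the upper block into the gap or to
-- odd residues below 2k. As 2k + 2ℓ ≡ -2k (mod p), the p-periodic extension of C
-- is independent in G({1, 2k, 2k + 2ℓ}). The window [-tp, tp] consists of 2t full
-- periods and one more point congruent to 0 ∈ C, so its density exceeds 2k/p.
module Submission where

open import Defs
open import Data.Bool using (Bool; true; false; not; if_then_else_)
open import Data.Bool.Properties using (not-injective)
open import Data.Empty using (⊥)
open import Data.Integer as ℤ using (ℤ; +_; -[1+_]; ∣_∣)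
import Data.Integer.Properties as ℤᵖ
import Data.Integer.Tactic.RingSolver as ℤ-RingSolver
open import Data.List using (_∷_; []; upTo; applyUpTo)
open import Data.List.Properties using (map-∘; map-upTo)
open import Data.List.Membership.Propositional using (_∈_)
open import Data.List.Relation.Unary.All as All using (All)
open import Data.Nat as ℕ using (ℕ; zero; suc; _+_; _*_; _∸_; _≤_; _<_; z≤n; s≤s; NonZero)
open import Data.Nat.DivMod
open import Data.Nat.ListAction using (sum)
open import Data.Nat.Properties
open import Data.Nat.Tactic.RingSolver using (solve; solve-∀)
open import Data.Product using (_×_; _,_; uncurry)
open import Data.Rational as ℚ using (0ℚ)
import Data.Rational.Properties as ℚᵖ
import Data.Rational.Unnormalised as ℚᵘ
import Data.Rational.Unnormalised.Properties as ℚᵘᵖ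
open import Data.Sum using (_⊎_; inj₁; inj₂)
open import Function using (_∘_)
open import Relation.Binary.PropositionalEquality
open import Relation.Nullary using (yes; no; contradiction)

true≢false : true ≢ false
true≢false ()

indicator : Bool → ℕ
indicator b = if b then 1 else 0

indicator≤1 : ∀ b → indicator b ≤ 1
indicator≤1 true  = s≤s z≤n
indicator≤1 false = z≤n

sum-applyUpTo-+ : ∀ (g : ℕ → ℕ) m n → sum (applyUpTo g (m + n)) ≡
                  sum (applyUpTo g m) + sum (applyUpTo (λ i → g (m + i)) n)
sum-applyUpTo-+ g zero    n = refl
sum-applyUpTo-+ g (suc m) n = trans (cong (_+_ (g 0)) (sum-applyUpTo-+ (g ∘ suc) m n))
                                    (sym (+-assoc (g 0) _ _))

sum-applyUpTo-cong : ∀ {f g : ℕ → ℕ} n → (∀ {i} → i < n → f i ≡ g i) →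
                     sum (applyUpTo f n) ≡ sum (applyUpTo g n)
sum-applyUpTo-cong zero    f≡g = refl
sum-applyUpTo-cong (suc n) f≡g =
  cong₂ _+_ (f≡g (s≤s z≤n)) (sum-applyUpTo-cong n (λ i<n → f≡g (s≤s i<n)))

sum-applyUpTo-periodic : ∀ (g : ℕ → ℕ) p → (∀ i → g (p + i) ≡ g i) →
                         ∀ m → sum (applyUpTo g (m * p)) ≡ m * sum (applyUpTo g p)
sum-applyUpTo-periodic g p g-periodic zero    = refl
sum-applyUpTo-periodic g p g-periodic (suc m) = begin
  sum (applyUpTo g (p + m * p))
    ≡⟨ sum-applyUpTo-+ g p (m * p) ⟩
  sum (applyUpTo g p) + sum (applyUpTo (λ i → g (p + i)) (m * p))
    ≡⟨ cong (_+_ (sum (applyUpTo g p))) (sum-applyUpTo-cong (m * p) (λ {i} _ → g-periodic i)) ⟩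
  sum (applyUpTo g p) + sum (applyUpTo g (m * p))
    ≡⟨ cong (_+_ (sum (applyUpTo g p))) (sum-applyUpTo-periodic g p g-periodic m) ⟩
  sum (applyUpTo g p) + m * sum (applyUpTo g p) ∎
  where open ≡-Reasoning

sum-indicator≤ : ∀ (F : ℕ → Bool) n → sum (applyUpTo (indicator ∘ F) n) ≤ n
sum-indicator≤ F zero    = z≤n
sum-indicator≤ F (suc n) = +-mono-≤ (indicator≤1 (F 0)) (sum-indicator≤ (F ∘ suc) n)

isEven : ℕ → Bool
isEven zero          = true
isEven (suc zero)    = false
isEven (suc (suc n)) = isEven n

isEven-suc : ∀ n → isEven (suc n) ≡ not (isEven n)
isEven-suc zero          = refl
isEven-suc (suc zero)    = refl
isEven-suc (suc (suc n)) = isEven-suc n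

isEven-+1 : ∀ n → isEven (n + 1) ≡ not (isEven n)
isEven-+1 n = trans (cong isEven (+-comm n 1)) (isEven-suc n)

isEven-double-+ : ∀ m n → isEven (2 * m + n) ≡ isEven n
isEven-double-+ zero    n = refl
isEven-double-+ (suc m) n = trans (cong isEven 2[1+m]+n≡2+[2m+n]) (isEven-double-+ m n)
  where
  2[1+m]+n≡2+[2m+n] : 2 * suc m + n ≡ 2 + (2 * m + n)
  2[1+m]+n≡2+[2m+n] = solve (m ∷ n ∷ [])

isEven-+-double : ∀ m n → isEven (n + 2 * m) ≡ isEven n
isEven-+-double m n = trans (cong isEven (+-comm n (2 * m))) (isEven-double-+ m n)

[m%d+n]%d≡[m+n]%d : ∀ m n d .{{_ : NonZero d}} → (m % d + n) % d ≡ (m + n) % d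
[m%d+n]%d≡[m+n]%d m n d = begin
  (m % d + n) % d           ≡⟨ %-distribˡ-+ (m % d) n d ⟩
  (m % d % d + n % d) % d   ≡⟨ cong (λ r → (r + n % d) % d) (m%n%n≡m%n m d) ⟩
  (m % d + n % d) % d       ≡⟨ %-distribˡ-+ m n d ⟨
  (m + n) % d               ∎
  where open ≡-Reasoning

%-wrap : ∀ {r d n} .{{_ : NonZero n}} → r < n → d < n →
         (r + d) % n ≡ r + d ⊎ (r + d) % n + n ≡ r + d
%-wrap {r} {d} {n} r<n d<n with r + d <? n
... | yes r+d<n = inj₁ (m<n⇒m%n≡m r+d<n)
... | no  r+d≮n = inj₂ (begin
  (r + d) % n + n     ≡⟨ cong (_+ n) (m≤n⇒[n∸m]%m≡n%m n≤r+d) ⟨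
  (r + d ∸ n) % n + n ≡⟨ cong (_+ n) (m<n⇒m%n≡m r+d∸n<n) ⟩
  r + d ∸ n + n       ≡⟨ m∸n+n≡m n≤r+d ⟩
  r + d               ∎)
  where
  open ≡-Reasoning
  n≤r+d : n ≤ r + d
  n≤r+d = ≮⇒≥ r+d≮n
  r+d∸n<n : r + d ∸ n < n
  r+d∸n<n = ≤-trans (∸-monoˡ-< (+-mono-< r<n d<n) n≤r+d) (≤-reflexive (m+n∸n≡m n n))

DistanceFree : ℕ → (ℤ → Bool) → Set
DistanceFree d A = ∀ x → A x ≡ true → A (x ℤ.+ + d) ≡ true → ⊥

i≤j⇒i+∣i-j∣≡j : ∀ {i j} → i ℤ.≤ j → i ℤ.+ + ∣ i ℤ.- j ∣ ≡ j
i≤j⇒i+∣i-j∣≡j {i} {j} i≤j = trans (cong (ℤ._+_ i) (ℤᵖ.∣-∣-≤ i≤j)) (i+[j-i]≡j i j)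
  where
  i+[j-i]≡j : ∀ i j → i ℤ.+ (j ℤ.- i) ≡ j
  i+[j-i]≡j = ℤ-RingSolver.solve-∀

distanceFree⇒independent : ∀ {S A} → All (λ d → DistanceFree d A) S → Independent S A
distanceFree⇒independent {S} {A} free i j Ai Aj i~j with ℤᵖ.≤-total i j
... | inj₁ i≤j = All.lookup free i~j i Ai (subst (λ x → A x ≡ true) (sym (i≤j⇒i+∣i-j∣≡j i≤j)) Aj)
... | inj₂ j≤i = All.lookup free (subst (_∈ S) (ℤᵖ.∣i-j∣≡∣j-i∣ i j) i~j) j Aj
                   (subst (λ x → A x ≡ true) (sym (i≤j⇒i+∣i-j∣≡j j≤i)) Ai)

-- For residues r, s < p and d < p, the two disjuncts say s ≡ r + d (mod p) without
-- and with wrap-around.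
CyclicallyAvoids : ℕ → (ℕ → Bool) → ℕ → Set
CyclicallyAvoids p F d = ∀ {r s} → F r ≡ true → F s ≡ true → s ≡ r + d ⊎ s + p ≡ r + d → ⊥

cyclicallyAvoids-complement : ∀ {p F d e} → p ≡ d + e →
                              CyclicallyAvoids p F d → CyclicallyAvoids p F e
cyclicallyAvoids-complement {p} {F} {d} {e} p≡d+e avoids {r} {s} Fr Fs (inj₁ s≡r+e) =
  avoids Fs Fr (inj₂ (begin
    r + p       ≡⟨ cong (_+_ r) p≡d+e ⟩
    r + (d + e) ≡⟨ solve (r ∷ d ∷ e ∷ []) ⟩
    r + e + d   ≡⟨ cong (_+ d) s≡r+e ⟨
    s + d       ∎))
  where open ≡-Reasoning
cyclicallyAvoids-complement {p} {F} {d} {e} p≡d+e avoids {r} {s} Fr Fs (inj₂ s+p≡r+e) =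
  avoids Fs Fr (inj₁ (+-cancelʳ-≡ e r (s + d) (begin
    r + e       ≡⟨ s+p≡r+e ⟨
    s + p       ≡⟨ cong (_+_ s) p≡d+e ⟩
    s + (d + e) ≡⟨ +-assoc s d e ⟨
    s + d + e   ∎)))
  where open ≡-Reasoning

-- + a / suc b is fromℚᵘ (mkℚᵘ (+ a) b), so the unnormalised cross-multiplication
-- order applies.
cross≤⇒/≤/ : ∀ {a b c d} → a * suc d ≤ c * suc b → + a ℚ./ suc b ℚ.≤ + c ℚ./ suc d
cross≤⇒/≤/ {a} {b} {c} {d} ad≤cb = ℚᵖ.toℚᵘ-cancel-≤
  (ℚᵘᵖ.≤-respʳ-≃ (ℚᵘᵖ.≃-sym (ℚᵖ.toℚᵘ-fromℚᵘ (ℚᵘ.mkℚᵘ (+ c) d)))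
  (ℚᵘᵖ.≤-respˡ-≃ (ℚᵘᵖ.≃-sym (ℚᵖ.toℚᵘ-fromℚᵘ (ℚᵘ.mkℚᵘ (+ a) b)))
  (ℚᵘ.*≤* (subst₂ ℤ._≤_ (ℤᵖ.pos-* a (suc d)) (ℤᵖ.pos-* c (suc b)) (ℤ.+≤+ ad≤cb)))))

p-q≤p : ∀ p {q} → 0ℚ ℚ.< q → p ℚ.- q ℚ.≤ p
p-q≤p p 0<q = ℚᵖ.≤-trans (ℚᵖ.+-monoʳ-≤ p (ℚᵖ.neg-antimono-≤ (ℚᵖ.<⇒≤ 0<q)))
                         (ℚᵖ.≤-reflexive (ℚᵖ.+-identityʳ p))

module Modulo (q : ℕ) where

  p : ℕ
  p = suc q

  -- Since q ≡ -1 (mod p), q * (n + 1) represents -(n + 1).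
  residue : ℤ → ℕ
  residue (+ n)    = n % p
  residue -[1+ n ] = q * suc n % p

  residue<p : ∀ x → residue x < p
  residue<p (+ n)    = m%n<n n p
  residue<p -[1+ n ] = m%n<n (q * suc n) p

  residue-idem : ∀ x → residue x % p ≡ residue x
  residue-idem (+ n)    = m%n%n≡m%n n p
  residue-idem -[1+ n ] = m%n%n≡m%n (q * suc n) p

  residue-+1 : ∀ x → residue (x ℤ.+ + 1) ≡ (residue x + 1) % p
  residue-+1 (+ n)          = sym ([m%d+n]%d≡[m+n]%d n 1 p)
  residue-+1 -[1+ zero ]    = begin
    0                   ≡⟨ n%n≡0 p ⟨
    p % p               ≡⟨ cong (_% p) 1+q≡q*1+1 ⟩
    (q * 1 + 1) % p     ≡⟨ [m%d+n]%d≡[m+n]%d (q * 1) 1 p ⟨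
    (q * 1 % p + 1) % p ∎
    where
    open ≡-Reasoning
    1+q≡q*1+1 : suc q ≡ q * 1 + 1
    1+q≡q*1+1 = solve (q ∷ [])
  residue-+1 -[1+ suc n ] = begin
    q * suc n % p                 ≡⟨ [m+n]%n≡m%n (q * suc n) p ⟨
    (q * suc n + p) % p           ≡⟨ cong (_% p) q[1+n]+p≡q[2+n]+1 ⟩
    (q * suc (suc n) + 1) % p     ≡⟨ [m%d+n]%d≡[m+n]%d (q * suc (suc n)) 1 p ⟨
    (q * suc (suc n) % p + 1) % p ∎
    where
    open ≡-Reasoning
    q[1+n]+p≡q[2+n]+1 : q * suc n + suc q ≡ q * suc (suc n) + 1
    q[1+n]+p≡q[2+n]+1 = solve (q ∷ n ∷ [])

  residue-+ : ∀ x d → residue (x ℤ.+ + d) ≡ (residue x + d) % p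
  residue-+ x zero    = begin
    residue (x ℤ.+ + 0) ≡⟨ cong residue (ℤᵖ.+-identityʳ x) ⟩
    residue x           ≡⟨ residue-idem x ⟨
    residue x % p       ≡⟨ cong (_% p) (+-identityʳ (residue x)) ⟨
    (residue x + 0) % p ∎
    where open ≡-Reasoning
  residue-+ x (suc d) = begin
    residue (x ℤ.+ + suc d)            ≡⟨ cong residue (ℤᵖ.+-assoc x (+ 1) (+ d)) ⟨
    residue (x ℤ.+ + 1 ℤ.+ + d)        ≡⟨ residue-+ (x ℤ.+ + 1) d ⟩
    (residue (x ℤ.+ + 1) + d) % p      ≡⟨ cong (λ r → (r + d) % p) (residue-+1 x) ⟩
    ((residue x + 1) % p + d) % p      ≡⟨ [m%d+n]%d≡[m+n]%d (residue x + 1) d p ⟩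
    (residue x + 1 + d) % p            ≡⟨ cong (_% p) (+-assoc (residue x) 1 d) ⟩
    (residue x + suc d) % p            ∎
    where open ≡-Reasoning

  residue-window : ∀ t i → residue (+ i ℤ.- + (t * p)) ≡ i % p
  residue-window t i = begin
    residue y                 ≡⟨ residue-idem y ⟨
    residue y % p             ≡⟨ [m+kn]%n≡m%n (residue y) t p ⟨
    (residue y + t * p) % p   ≡⟨ residue-+ y (t * p) ⟨
    residue (y ℤ.+ + (t * p)) ≡⟨ cong residue (i-j+j≡i (+ i) (+ (t * p))) ⟩
    i % p                     ∎
    where
    open ≡-Reasoning
    y : ℤ
    y = + i ℤ.- + (t * p)
    i-j+j≡i : ∀ i j → i ℤ.- j ℤ.+ j ≡ i
    i-j+j≡i = ℤ-RingSolver.solve-∀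

  periodic : (ℕ → Bool) → ℤ → Bool
  periodic F x = F (residue x)

  periodic-distanceFree : ∀ {F d} → d < p → CyclicallyAvoids p F d → DistanceFree d (periodic F)
  periodic-distanceFree {F} {d} d<p avoids x Fx Fx+d with %-wrap (residue<p x) d<p
  ... | inj₁ no-wrap = avoids Fx Fx+d (inj₁ (trans (residue-+ x d) no-wrap))
  ... | inj₂ wrap    = avoids Fx Fx+d (inj₂ (trans (cong (_+ p) (residue-+ x d)) wrap))

  periodic-independent : ∀ {F S} → All (λ d → d < p × CyclicallyAvoids p F d) S →
                         Independent S (periodic F)
  periodic-independent avoids =
    distanceFree⇒independent (All.map (uncurry periodic-distanceFree) avoids)

  count-periodic : ∀ F t → count (periodic F) (t * p) ≡
                   (t + t) * sum (applyUpTo (indicator ∘ F) p) + indicator (F 0)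
  count-periodic F t = begin
    count (periodic F) (t * p)
      ≡⟨ cong sum (trans (sym (map-∘ (upTo M))) (map-upTo _ M)) ⟩
    sum (applyUpTo (λ i → indicator (periodic F (+ i ℤ.- + (t * p)))) M)
      ≡⟨ sum-applyUpTo-cong M (λ {i} _ → cong (indicator ∘ F) (residue-window t i)) ⟩
    sum (applyUpTo g M)
      ≡⟨ cong (sum ∘ applyUpTo g) M≡[t+t]p+1 ⟩
    sum (applyUpTo g ((t + t) * p + 1))
      ≡⟨ sum-applyUpTo-+ g ((t + t) * p) 1 ⟩
    sum (applyUpTo g ((t + t) * p)) + (g ((t + t) * p + 0) + 0)
      ≡⟨ cong₂ _+_ (sum-applyUpTo-periodic g p g-periodic (t + t)) last-term ⟩
    (t + t) * sum (applyUpTo g p) + indicator (F 0)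
      ≡⟨ cong (λ s → (t + t) * s + indicator (F 0))
              (sum-applyUpTo-cong p (λ i<p → cong (indicator ∘ F) (m<n⇒m%n≡m i<p))) ⟩
    (t + t) * sum (applyUpTo (indicator ∘ F) p) + indicator (F 0) ∎
    where
    open ≡-Reasoning
    M : ℕ
    M = suc (t * p + t * p)
    g : ℕ → ℕ
    g i = indicator (F (i % p))
    -- stated with suc q, as the ring solver does not unfold p
    M≡[t+t]p+1 : suc (t * suc q + t * suc q) ≡ (t + t) * suc q + 1
    M≡[t+t]p+1 = solve (t ∷ q ∷ [])
    g-periodic : ∀ i → g (p + i) ≡ g i
    g-periodic i = cong (indicator ∘ F) (trans (cong (_% p) (+-comm p i)) ([m+n]%n≡m%n i p))
    last-term : g ((t + t) * p + 0) + 0 ≡ indicator (F 0)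
    last-term = trans (+-identityʳ _)
      (cong (indicator ∘ F) (trans (cong (_% p) (+-identityʳ ((t + t) * p))) (m*n%n≡0 (t + t) p)))

  periodic-ratio≥ : ∀ {F a} → F 0 ≡ true → a ≤ sum (applyUpTo (indicator ∘ F) p) →
                    ∀ t → frac a p ℚ.≤ ratio (periodic F) (t * p)
  periodic-ratio≥ {F} {a} F0 a≤Σ t =
    cross≤⇒/≤/ {a} {q} {count (periodic F) (t * p)} {t * p + t * p} (begin
    a * suc (t * p + t * p)        ≡⟨ cong (λ n → a * suc n) (*-distribʳ-+ p t t) ⟨
    a * suc (m * p)                ≡⟨ a[1+mp]≡map+a a m p ⟩
    m * a * p + a                  ≤⟨ +-monoʳ-≤ (m * a * p) a≤p ⟩
    m * a * p + p                  ≡⟨ map+p≡[ma+1]p m a p ⟩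
    (m * a + 1) * p                ≤⟨ *-monoˡ-≤ p (+-monoˡ-≤ 1 (*-monoʳ-≤ m a≤Σ)) ⟩
    (m * Σ + 1) * p                ≡⟨ cong (_* p) count≡mΣ+1 ⟨
    count (periodic F) (t * p) * p ∎)
    where
    open ≤-Reasoning
    m Σ : ℕ
    m = t + t
    Σ = sum (applyUpTo (indicator ∘ F) p)
    a≤p : a ≤ p
    a≤p = ≤-trans a≤Σ (sum-indicator≤ F p)
    count≡mΣ+1 : count (periodic F) (t * p) ≡ m * Σ + 1
    count≡mΣ+1 = trans (count-periodic F t) (cong (λ b → m * Σ + indicator b) F0)
    a[1+mp]≡map+a : ∀ a m p → a * suc (m * p) ≡ m * a * p + a
    a[1+mp]≡map+a = solve-∀
    map+p≡[ma+1]p : ∀ m a p → m * a * p + p ≡ (m * a + 1) * p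
    map+p≡[ma+1]p = solve-∀

4*n≡2*n+2*n : ∀ n → 4 * n ≡ 2 * n + 2 * n
4*n≡2*n+2*n = solve-∀

module EvenThenOdd (k : ℕ) where

  evenThenOdd : ℕ → Bool
  evenThenOdd r with r <? 2 * k
  ... | yes _ = isEven r
  ... | no  _ with r <? 4 * k
  ...   | yes _ = not (isEven r)
  ...   | no  _ = false

  data InEvenThenOdd (r : ℕ) : Set where
    lower : r < 2 * k → isEven r ≡ true → InEvenThenOdd r
    upper : 2 * k ≤ r → r < 4 * k → isEven r ≡ false → InEvenThenOdd r

  evenThenOdd-view : ∀ {r} → evenThenOdd r ≡ true → InEvenThenOdd r
  evenThenOdd-view {r} r∈ with r <? 2 * k
  ... | yes r<2k = lower r<2k r∈
  ... | no  r≮2k with r <? 4 * k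
  ...   | yes r<4k = upper (≮⇒≥ r≮2k) r<4k (not-injective r∈)
  evenThenOdd-view () | no _ | no _

  evenThenOdd<4k : ∀ {r} → evenThenOdd r ≡ true → r < 4 * k
  evenThenOdd<4k r∈ with evenThenOdd-view r∈
  ... | lower r<2k _   = ≤-trans r<2k
                           (≤-trans (m≤m+n (2 * k) (2 * k)) (≤-reflexive (sym (4*n≡2*n+2*n k))))
  ... | upper _ r<4k _ = r<4k

  evenThenOdd-lower : ∀ {i} → i < 2 * k → evenThenOdd i ≡ isEven i
  evenThenOdd-lower {i} i<2k with i <? 2 * k
  ... | yes _    = refl
  ... | no  i≮2k = contradiction i<2k i≮2k

  evenThenOdd-upper : ∀ {i} → i < 2 * k → evenThenOdd (2 * k + i) ≡ not (isEven i)
  evenThenOdd-upper {i} i<2k with 2 * k + i <? 2 * k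
  ... | yes 2k+i<2k = contradiction (m≤m+n (2 * k) i) (<⇒≱ 2k+i<2k)
  ... | no  _ with 2 * k + i <? 4 * k
  ...   | yes _       = cong not (isEven-double-+ k i)
  ...   | no  2k+i≮4k = contradiction 2k+i<4k 2k+i≮4k
    where
    2k+i<4k : 2 * k + i < 4 * k
    2k+i<4k = ≤-trans (+-monoʳ-< (2 * k) i<2k) (≤-reflexive (sym (4*n≡2*n+2*n k)))

  evenThenOdd-count : ∀ n → 2 * k ≤ sum (applyUpTo (indicator ∘ evenThenOdd) (4 * k + n))
  evenThenOdd-count n = begin
    2 * k
      ≡⟨ cong (_+_ k) (+-identityʳ k) ⟩
    k + k
      ≡⟨ cong₂ _+_ (alternating-sum isEven (λ _ → refl) refl)
                   (alternating-sum (not ∘ isEven) (λ _ → refl) refl) ⟨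
    sum (applyUpTo (indicator ∘ isEven) (2 * k)) + sum (applyUpTo (indicator ∘ not ∘ isEven) (2 * k))
      ≡⟨ cong₂ _+_ (sum-applyUpTo-cong (2 * k) (λ i<2k → cong indicator (sym (evenThenOdd-lower i<2k))))
                   (sum-applyUpTo-cong (2 * k) (λ i<2k → cong indicator (sym (evenThenOdd-upper i<2k)))) ⟩
    sum (applyUpTo g (2 * k)) + sum (applyUpTo (λ i → g (2 * k + i)) (2 * k))
      ≡⟨ sum-applyUpTo-+ g (2 * k) (2 * k) ⟨
    sum (applyUpTo g (2 * k + 2 * k))
      ≤⟨ m≤m+n _ _ ⟩
    sum (applyUpTo g (2 * k + 2 * k)) + sum (applyUpTo (λ i → g (2 * k + 2 * k + i)) n)
      ≡⟨ sum-applyUpTo-+ g (2 * k + 2 * k) n ⟨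
    sum (applyUpTo g (2 * k + 2 * k + n))
      ≡⟨ cong (λ m → sum (applyUpTo g (m + n))) (4*n≡2*n+2*n k) ⟨
    sum (applyUpTo g (4 * k + n)) ∎
    where
    open ≤-Reasoning
    g : ℕ → ℕ
    g = indicator ∘ evenThenOdd
    alternating-sum : ∀ (F : ℕ → Bool) → (∀ i → F (2 + i) ≡ F i) →
                      sum (applyUpTo (indicator ∘ F) 2) ≡ 1 → sum (applyUpTo (indicator ∘ F) (2 * k)) ≡ k
    alternating-sum F F-periodic one =
      trans (cong (sum ∘ applyUpTo (indicator ∘ F)) (*-comm 2 k))
      (trans (sum-applyUpTo-periodic (indicator ∘ F) 2 (cong indicator ∘ F-periodic) k)
      (trans (cong (k *_) one) (*-identityʳ k)))

  evenThenOdd-avoids-1 : ∀ {ℓ} → 1 ≤ ℓ → CyclicallyAvoids (4 * k + 2 * ℓ) evenThenOdd 1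
  evenThenOdd-avoids-1 _ {r} r∈ s∈ (inj₁ refl) = adjacent (evenThenOdd-view r∈) (evenThenOdd-view s∈)
    where
    adjacent : InEvenThenOdd r → InEvenThenOdd (r + 1) → ⊥
    adjacent (lower _ er) (lower _ er+1) =
      true≢false (trans (sym er+1) (trans (isEven-+1 r) (cong not er)))
    adjacent (upper _ _ er) (upper _ _ er+1) =
      true≢false (trans (sym (cong not er)) (trans (sym (isEven-+1 r)) er+1))
    adjacent (lower r<2k _) (upper 2k≤r+1 _ er+1) =
      true≢false (trans (sym (isEven-+-double k 0)) (trans (cong isEven 2k≡r+1) er+1))
      where
      2k≡r+1 : 2 * k ≡ r + 1
      2k≡r+1 = ≤-antisym 2k≤r+1 (≤-trans (≤-reflexive (+-comm r 1)) r<2k)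
    adjacent (upper 2k≤r _ _) (lower r+1<2k _) = <⇒≱ r+1<2k (≤-trans 2k≤r (m≤m+n r 1))
  evenThenOdd-avoids-1 {ℓ} 1≤ℓ {r} {s} r∈ s∈ (inj₂ s+p≡r+1) =
    <⇒≱ (evenThenOdd<4k r∈) (+-cancelʳ-≤ 1 (4 * k) r (begin
      4 * k + 1           ≤⟨ +-monoʳ-≤ (4 * k) (≤-trans 1≤ℓ (m≤n*m ℓ 2)) ⟩
      4 * k + 2 * ℓ       ≤⟨ m≤n+m (4 * k + 2 * ℓ) s ⟩
      s + (4 * k + 2 * ℓ) ≡⟨ s+p≡r+1 ⟩
      r + 1               ∎))
    where open ≤-Reasoning

  evenThenOdd-avoids-2k : ∀ {ℓ} → CyclicallyAvoids (4 * k + 2 * ℓ) evenThenOdd (2 * k)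
  evenThenOdd-avoids-2k {r = r} r∈ s∈ (inj₁ refl) = shifted (evenThenOdd-view r∈) (evenThenOdd-view s∈)
    where
    shifted : InEvenThenOdd r → InEvenThenOdd (r + 2 * k) → ⊥
    shifted (lower _ _) (lower r+2k<2k _) = <⇒≱ r+2k<2k (m≤n+m (2 * k) r)
    shifted (lower _ er) (upper _ _ er+2k) =
      true≢false (trans (sym er) (trans (sym (isEven-+-double k r)) er+2k))
    shifted (upper 2k≤r _ _) _ = <⇒≱ (evenThenOdd<4k s∈)
      (≤-trans (≤-reflexive (4*n≡2*n+2*n k)) (+-monoˡ-≤ (2 * k) 2k≤r))
  evenThenOdd-avoids-2k {ℓ} {r} {s} r∈ s∈ (inj₂ s+p≡r+2k) = wrapped (evenThenOdd-view r∈) (evenThenOdd-view s∈)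
    where
    s+[4k+2ℓ]≡s+2[k+ℓ]+2k : ∀ s k ℓ → s + (4 * k + 2 * ℓ) ≡ s + 2 * (k + ℓ) + 2 * k
    s+[4k+2ℓ]≡s+2[k+ℓ]+2k = solve-∀
    r≡s+2[k+ℓ] : r ≡ s + 2 * (k + ℓ)
    r≡s+2[k+ℓ] = +-cancelʳ-≡ (2 * k) r (s + 2 * (k + ℓ))
                   (trans (sym s+p≡r+2k) (s+[4k+2ℓ]≡s+2[k+ℓ]+2k s k ℓ))
    2k≤2[k+ℓ] : 2 * k ≤ 2 * (k + ℓ)
    2k≤2[k+ℓ] = *-monoʳ-≤ 2 (m≤m+n k ℓ)
    wrapped : InEvenThenOdd r → InEvenThenOdd s → ⊥
    wrapped (lower r<2k _) _ =
      <⇒≱ r<2k (≤-trans 2k≤2[k+ℓ] (≤-trans (m≤n+m _ s) (≤-reflexive (sym r≡s+2[k+ℓ]))))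
    wrapped (upper _ _ er) (lower _ es) =
      true≢false (trans (sym es) (trans (sym (isEven-+-double (k + ℓ) s))
                 (trans (cong isEven (sym r≡s+2[k+ℓ])) er)))
    wrapped (upper _ r<4k _) (upper 2k≤s _ _) = <⇒≱ r<4k (begin
      4 * k               ≡⟨ 4*n≡2*n+2*n k ⟩
      2 * k + 2 * k       ≤⟨ +-mono-≤ 2k≤s 2k≤2[k+ℓ] ⟩
      s + 2 * (k + ℓ)     ≡⟨ r≡s+2[k+ℓ] ⟨
      r                   ∎)
      where open ≤-Reasoning

  evenThenOdd-avoids : ∀ {ℓ} → 1 ≤ k → 1 ≤ ℓ →
    All (λ d → d < 4 * k + 2 * ℓ × CyclicallyAvoids (4 * k + 2 * ℓ) evenThenOdd d)
        (1 ∷ 2 * k ∷ 2 * k + 2 * ℓ ∷ [])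
  evenThenOdd-avoids {ℓ} 1≤k 1≤ℓ =
    (1<p , evenThenOdd-avoids-1 1≤ℓ) All.∷
    (2k<p , evenThenOdd-avoids-2k {ℓ}) All.∷
    (2k+2ℓ<p , cyclicallyAvoids-complement (4k+2ℓ≡2k+[2k+2ℓ] k ℓ) (evenThenOdd-avoids-2k {ℓ})) All.∷
    All.[]
    where
    4k+2ℓ≡2k+[2k+2ℓ] : ∀ k ℓ → 4 * k + 2 * ℓ ≡ 2 * k + (2 * k + 2 * ℓ)
    4k+2ℓ≡2k+[2k+2ℓ] = solve-∀
    1≤2k : 1 ≤ 2 * k
    1≤2k = ≤-trans 1≤k (m≤n*m k 2)
    2k+2ℓ<p : 2 * k + 2 * ℓ < 4 * k + 2 * ℓ
    2k+2ℓ<p = +-monoˡ-< (2 * ℓ)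
      (≤-trans (m<m+n (2 * k) 1≤2k) (≤-reflexive (sym (4*n≡2*n+2*n k))))
    2k<p : 2 * k < 4 * k + 2 * ℓ
    2k<p = ≤-<-trans (m≤m+n (2 * k) (2 * ℓ)) 2k+2ℓ<p
    1<p : 1 < 4 * k + 2 * ℓ
    1<p = ≤-<-trans (≤-trans 1≤2k (m≤m+n (2 * k) (2 * ℓ))) 2k+2ℓ<p

-- The hypothesis ℓ ≤ k only serves to exclude k = 0; for k ≥ 1 the period
-- 4k + 2ℓ is a successor, so Modulo can be instantiated at its predecessor.
lemma30 : (k ℓ : ℕ) → 1 ≤ ℓ → ℓ ≤ k →
    IndependenceRatio≥ (1 ∷ 2 * k ∷ 2 * k + 2 * ℓ ∷ []) (frac (2 * k) (4 * k + 2 * ℓ))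
lemma30 zero      (suc ℓ) _   ()
lemma30 k@(suc _) ℓ       1≤ℓ _  ε 0<ε =
  periodic evenThenOdd ,
  periodic-independent (evenThenOdd-avoids (s≤s z≤n) 1≤ℓ) ,
  λ N₀ → N₀ * p , m≤m*n N₀ p ,
    ℚᵖ.≤-trans (p-q≤p _ 0<ε)
               (periodic-ratio≥ {evenThenOdd} (evenThenOdd-lower (s≤s z≤n)) (evenThenOdd-count (2 * ℓ)) N₀)
  where
  open Modulo (ℕ.pred (4 * k + 2 * ℓ))
  open EvenThenOdd k
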